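{- Let $k$ be a commutative ring, let $a\in k$, let $k[\omega]=k[x]/(x^2-x-a)$ with $\omega$ the class of $x$, and set $\overline{\omega}=1-\omega$, $\delta=\omega-\overline{\omega}$ and $D=\delta^2=1+4a$. Let $C/k$ be an elliptic curve in $\mathbb{P}^3$ given by one of the following three models: (i) ($\boldsymbol{\mu}_4$-normal form) $X_0^2 - rX_2^2 = X_1X_3,\ X_1^2-X_3^2 = X_0X_2$, with identity $O=(1:1:0:1)$; (ii) (semisplit $\boldsymbol{\mu}_4$-normal form) $X_0^2 - X_2^2 = X_1X_3,\ X_1^2-X_3^2 = sX_0X_2$, with identity $O=(1:1:0:1)$; (iii) (split $\boldsymbol{\mu}_4$-normal form) $X_0^2 - X_2^2 = c^2X_1X_3,\ X_1^2-X_3^2 = c^2X_0X_2$, with identity $O=(c:1:0:1)$. Then the quadratic twist $C^t$ of $C$ by $k[\omega]$ is given, respectively, by (i) $X_0^2 - Dr\,X_2^2 = X_1X_3 - a(X_1-X_3)^2,\ X_1^2-X_3^2 = X_0X_2$, with identity $(1:1:0:1)$; (ii) $X_0^2 - D\,X_2^2 = X_1X_3 - a(X_1-X_3)^2,\ X_1^2-X_3^2 = sX_0X_2$, with identity $(1:1:0:1)$; (iii) $X_0^2 - D\,X_2^2 = c^2(X_1X_3 - a(X_1-X_3)^2),\ X_1^2-X_3^2 = c^2X_0X_2$, with identity $(c:1:0:1)$; and in each case the twisting isomorphism $\tau: C\to C^t$ (defined over $k[\omega]$) is $$(X_0:X_1:X_2:X_3)\longmapsto(\delta X_0:\omega X_1-\overline{\omega}X_3:X_2:\omega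 X_3-\overline{\omega}X_1),$$ with inverse $(X_0:X_1:X_2:X_3)\longmapsto(X_0:\omega X_1+\overline{\omega}X_3:\delta X_2:\overline{\omega}X_1+\omega X_3)$.
   Context: A quadratic twist of $C/k$ by $k[\omega]/k$ is a curve $C^t/k$ together with an isomorphism $\tau: C\to C^t$ defined over $k[\omega]$ such that $\tau^\sigma = [-1]\circ\tau$, where $\sigma$ is the nontrivial automorphism of $k[\omega]/k$ (sending $\omega\mapsto\overline{\omega}$). On each of these models the negation map is $[-1](X_0:X_1:X_2:X_3)=(X_0:X_3:-X_2:X_1)$. -}

module Defs where

open import Level using (Level; _⊔_)
open import Data.Product using (_×_; _,_)
open import Algebra.Bundles using (CommutativeRing)

-- Points of the affine cone over P^3 with coordinates in a set A
-- (homogeneous coordinates (X0 : X1 : X2 : X3)).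
record Pt {a} (A : Set a) : Set a where
  constructor pt
  field
    x0 x1 x2 x3 : A

data Model {a} (A : Set a) : Set a where
  mu4       : (r : A) → Model A
  semisplit : (s : A) → Model A
  split     : (c : A) → Model A

mapModel : ∀ {a b} {A : Set a} {B : Set b} → (A → B) → Model A → Model B
mapModel f (mu4 r)       = mu4 (f r)
mapModel f (semisplit s) = semisplit (f s)
mapModel f (split c)     = split (f c)

-- All the following constructions take place with coordinates in a
-- commutative ring R (a k[ω]-algebra in the theorem).
module _ {c ℓ : Level} (R : CommutativeRing c ℓ) where
  open CommutativeRing R

  _≋_ : Pt Carrier → Pt Carrier → Set ℓ
  pt a0 a1 a2 a3 ≋ pt b0 b1 b2 b3 = (a0 ≈ b0) × (a1 ≈ b1) × (a2 ≈ b2) × (a3 ≈ b3)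

  scale : Carrier → Pt Carrier → Pt Carrier
  scale λ' (pt X0 X1 X2 X3) = pt (λ' * X0) (λ' * X1) (λ' * X2) (λ' * X3)

  neg : Pt Carrier → Pt Carrier
  neg (pt X0 X1 X2 X3) = pt X0 X3 (- X2) X1

  four : Carrier
  four = 1# + 1# + 1# + 1#

  discD : Carrier → Carrier
  discD a = 1# + four * a

  OnC : Model Carrier → Pt Carrier → Set ℓ
  OnC (mu4 r) (pt X0 X1 X2 X3) =
    (X0 * X0 - r * (X2 * X2) ≈ X1 * X3) × (X1 * X1 - X3 * X3 ≈ X0 * X2)
  OnC (semisplit s) (pt X0 X1 X2 X3) =
    (X0 * X0 - X2 * X2 ≈ X1 * X3) × (X1 * X1 - X3 * X3 ≈ s * (X0 * X2))
  OnC (split c) (pt X0 X1 X2 X3) =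
    (X0 * X0 - X2 * X2 ≈ (c * c) * (X1 * X3)) × (X1 * X1 - X3 * X3 ≈ (c * c) * (X0 * X2))

  OnCt : Carrier → Model Carrier → Pt Carrier → Set ℓ
  OnCt a (mu4 r) (pt X0 X1 X2 X3) =
    (X0 * X0 - (discD a * r) * (X2 * X2) ≈ X1 * X3 - a * ((X1 - X3) * (X1 - X3)))
    × (X1 * X1 - X3 * X3 ≈ X0 * X2)
  OnCt a (semisplit s) (pt X0 X1 X2 X3) =
    (X0 * X0 - discD a * (X2 * X2) ≈ X1 * X3 - a * ((X1 - X3) * (X1 - X3)))
    × (X1 * X1 - X3 * X3 ≈ s * (X0 * X2))
  OnCt a (split c) (pt X0 X1 X2 X3) =
    (X0 * X0 - discD a * (X2 * X2) ≈ (c * c) * (X1 * X3 - a * ((X1 - X3) * (X1 - X3))))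
    × (X1 * X1 - X3 * X3 ≈ (c * c) * (X0 * X2))

  -- identity point O of C (the twist C^t has the same identity point)
  origin : Model Carrier → Pt Carrier
  origin (mu4 r)       = pt 1# 1# 0# 1#
  origin (semisplit s) = pt 1# 1# 0# 1#
  origin (split c)     = pt c 1# 0# 1#

  conj : Carrier → Carrier
  conj w = 1# - w

  delta : Carrier → Carrier
  delta w = w - conj w

  tau : Carrier → Pt Carrier → Pt Carrier
  tau w (pt X0 X1 X2 X3) =
    pt (delta w * X0) (w * X1 - conj w * X3) X2 (w * X3 - conj w * X1)

  tauInv : Carrier → Pt Carrier → Pt Carrier
  tauInv w (pt X0 X1 X2 X3) =
    pt X0 (w * X1 + conj w * X3) (delta w * X2) (conj w * X1 + w * X3)

{-# OPTIONS --safe #-}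
-- Over k[ω] put ω̄ = 1 − ω, so that ωω̄ = −a and δ² = 1 − 4ωω̄ = D. All three models are
-- instances of X0² − αX2² = βX1X3, X1² − X3² = γX0X2, and the twist replaces the first
-- equation by X0² − DαX2² = β(X1X3 − a(X1 − X3)²). The map τ acts on (X1, X3) by a linear
-- substitution of determinant δ: it multiplies X1² − X3² by δ and carries the form
-- X1X3 − a(X1 − X3)² to D·X1X3, while τ⁻¹ carries X1X3 back to X1X3 − a(X1 − X3)².
-- Since X0 (resp. X2) is scaled by δ and δ² = D, both equations are preserved. The
-- remaining claims are polynomial identities in ω alone.
module Submission where

open import Defs
open import Level using (Level)
open import Data.Product using (_×_; _,_)
open import Algebra.Bundles using (CommutativeRing)
open import Algebra.Morphism.Structures using (IsRingHomomorphism)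

open import Data.Nat as ℕ using (zero; suc)
open import Data.Integer as ℤ using (ℤ; +_; -[1+_]; _⊖_)
import Data.Integer.Properties as ℤ
import Data.Nat.Properties as ℕ
open import Data.Sign as Sign using (Sign)
open import Data.Maybe using (Maybe; just; nothing)
open import Function.Bundles using (_⇔_; mk⇔; Equivalence)
open import Data.Product.Function.NonDependent.Propositional using (_×-⇔_)
open import Relation.Nullary using (yes; no)
import Relation.Binary.PropositionalEquality as ≡
import Algebra.Solver.Ring.AlmostCommutativeRing as AlmostCommutativeRing
import Algebra.Solver.Ring as RingSolver

-- The ring solver needs coefficients whose equality computes; ℤ maps into every ring.
module IntegerCoefficientSolver {c ℓ} (R : CommutativeRing c ℓ) where
  open CommutativeRing R
  open import Algebra.Properties.Semiring.Mult.TCOptimised semiring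
    using (1+×; ×-homo-+; ×1-homo-*; ×-cong) renaming (_×_ to _×ₙ_)
  open import Algebra.Properties.Ring ring
    using (-0#≈0#; -‿involutive; -‿distribˡ-*; -‿distribʳ-*; -‿+-comm)
  open import Relation.Binary.Reasoning.Setoid setoid

  ⟦_⟧ : ℤ → Carrier
  ⟦ + n ⟧      = n ×ₙ 1#
  ⟦ -[1+ n ] ⟧ = - (suc n ×ₙ 1#)

  signed : Sign → Carrier → Carrier
  signed Sign.+ x = x
  signed Sign.- x = - x

  signed-cong : ∀ s {x y} → x ≈ y → signed s x ≈ signed s y
  signed-cong Sign.+ x≈y = x≈y
  signed-cong Sign.- x≈y = -‿cong x≈y

  signed-* : ∀ s t x y → signed (s Sign.* t) (x * y) ≈ signed s x * signed t y
  signed-* Sign.+ Sign.+ x y = refl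
  signed-* Sign.+ Sign.- x y = -‿distribʳ-* x y
  signed-* Sign.- Sign.+ x y = -‿distribˡ-* x y
  signed-* Sign.- Sign.- x y = begin
    x * y         ≈⟨ sym (-‿involutive (x * y)) ⟩
    - - (x * y)   ≈⟨ -‿cong (-‿distribʳ-* x y) ⟩
    - (x * - y)   ≈⟨ -‿distribˡ-* x (- y) ⟩
    - x * - y     ∎

  ⟦◃⟧ : ∀ s n → ⟦ s ℤ.◃ n ⟧ ≈ signed s (n ×ₙ 1#)
  ⟦◃⟧ Sign.+ zero    = refl
  ⟦◃⟧ Sign.- zero    = sym -0#≈0#
  ⟦◃⟧ Sign.+ (suc n) = refl
  ⟦◃⟧ Sign.- (suc n) = refl

  ⟦⟧≈signed-∣∣ : ∀ i → ⟦ i ⟧ ≈ signed (ℤ.sign i) (ℤ.∣ i ∣ ×ₙ 1#)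
  ⟦⟧≈signed-∣∣ (+ zero)  = refl
  ⟦⟧≈signed-∣∣ (+ suc n) = refl
  ⟦⟧≈signed-∣∣ -[1+ n ]  = refl

  ⟦⟧-*-homo : ∀ i j → ⟦ i ℤ.* j ⟧ ≈ ⟦ i ⟧ * ⟦ j ⟧
  ⟦⟧-*-homo i j = begin
    ⟦ i ℤ.* j ⟧                                     ≈⟨ ⟦◃⟧ (s Sign.* t) (m ℕ.* n) ⟩
    signed (s Sign.* t) ((m ℕ.* n) ×ₙ 1#)           ≈⟨ signed-cong (s Sign.* t) (×1-homo-* m n) ⟩
    signed (s Sign.* t) ((m ×ₙ 1#) * (n ×ₙ 1#))     ≈⟨ signed-* s t _ _ ⟩
    signed s (m ×ₙ 1#) * signed t (n ×ₙ 1#)         ≈⟨ *-cong (sym (⟦⟧≈signed-∣∣ i)) (sym (⟦⟧≈signed-∣∣ j)) ⟩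
    ⟦ i ⟧ * ⟦ j ⟧                                   ∎
    where
    s = ℤ.sign i
    t = ℤ.sign j
    m = ℤ.∣ i ∣
    n = ℤ.∣ j ∣

  ⟦⟧-‿homo : ∀ i → ⟦ ℤ.- i ⟧ ≈ - ⟦ i ⟧
  ⟦⟧-‿homo (+ zero)  = sym -0#≈0#
  ⟦⟧-‿homo (+ suc n) = refl
  ⟦⟧-‿homo -[1+ n ]  = sym (-‿involutive _)

  [1+x]-[1+y]≈x-y : ∀ x y → (1# + x) - (1# + y) ≈ x - y
  [1+x]-[1+y]≈x-y x y = begin
    (1# + x) - (1# + y)       ≈⟨ +-congˡ (sym (-‿+-comm 1# y)) ⟩
    (1# + x) + (- 1# + - y)   ≈⟨ sym (+-assoc (1# + x) (- 1#) (- y)) ⟩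
    ((1# + x) + - 1#) + - y   ≈⟨ +-congʳ (+-congʳ (+-comm 1# x)) ⟩
    ((x + 1#) + - 1#) + - y   ≈⟨ +-congʳ (+-assoc x 1# (- 1#)) ⟩
    (x + (1# + - 1#)) + - y   ≈⟨ +-congʳ (+-congˡ (-‿inverseʳ 1#)) ⟩
    (x + 0#) + - y            ≈⟨ +-congʳ (+-identityʳ x) ⟩
    x - y                     ∎

  ⟦⊖⟧ : ∀ m n → ⟦ m ⊖ n ⟧ ≈ m ×ₙ 1# - n ×ₙ 1#
  ⟦⊖⟧ zero    zero    = trans (sym (+-identityʳ 0#)) (+-congˡ (sym -0#≈0#))
  ⟦⊖⟧ zero    (suc n) = sym (+-identityˡ _)
  ⟦⊖⟧ (suc m) zero    = trans (sym (+-identityʳ _)) (+-congˡ (sym -0#≈0#))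
  ⟦⊖⟧ (suc m) (suc n) = begin
    ⟦ suc m ⊖ suc n ⟧                 ≡⟨ ≡.cong ⟦_⟧ (ℤ.[1+m]⊖[1+n]≡m⊖n m n) ⟩
    ⟦ m ⊖ n ⟧                         ≈⟨ ⟦⊖⟧ m n ⟩
    m ×ₙ 1# - n ×ₙ 1#                 ≈⟨ sym ([1+x]-[1+y]≈x-y _ _) ⟩
    (1# + m ×ₙ 1#) - (1# + n ×ₙ 1#)   ≈⟨ +-cong (sym (1+× m 1#)) (-‿cong (sym (1+× n 1#))) ⟩
    suc m ×ₙ 1# - suc n ×ₙ 1#         ∎

  ⟦⟧-+-homo : ∀ i j → ⟦ i ℤ.+ j ⟧ ≈ ⟦ i ⟧ + ⟦ j ⟧
  ⟦⟧-+-homo (+ m)    (+ n)    = ×-homo-+ 1# m n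
  ⟦⟧-+-homo (+ m)    -[1+ n ] = ⟦⊖⟧ m (suc n)
  ⟦⟧-+-homo -[1+ m ] (+ n)    = trans (⟦⊖⟧ n (suc m)) (+-comm _ _)
  ⟦⟧-+-homo -[1+ m ] -[1+ n ] = begin
    - (suc (suc (m ℕ.+ n)) ×ₙ 1#)          ≈⟨ -‿cong (×-cong (≡.cong suc (≡.sym (ℕ.+-suc m n))) refl) ⟩
    - ((suc m ℕ.+ suc n) ×ₙ 1#)            ≈⟨ -‿cong (×-homo-+ 1# (suc m) (suc n)) ⟩
    - (suc m ×ₙ 1# + suc n ×ₙ 1#)          ≈⟨ sym (-‿+-comm _ _) ⟩
    - (suc m ×ₙ 1#) + - (suc n ×ₙ 1#)      ∎

  homomorphism : ℤ.+-*-rawRing AlmostCommutativeRing.-Raw-AlmostCommutative⟶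
                 AlmostCommutativeRing.fromCommutativeRing R
  homomorphism = record
    { ⟦_⟧    = ⟦_⟧
    ; +-homo = ⟦⟧-+-homo
    ; *-homo = ⟦⟧-*-homo
    ; -‿homo = ⟦⟧-‿homo
    ; 0-homo = refl
    ; 1-homo = refl
    }

  ⟦⟧-≟ : ∀ i j → Maybe (⟦ i ⟧ ≈ ⟦ j ⟧)
  ⟦⟧-≟ i j with i ℤ.≟ j
  ... | yes ≡.refl = just refl
  ... | no _       = nothing

  open RingSolver ℤ.+-*-rawRing (AlmostCommutativeRing.fromCommutativeRing R) homomorphism ⟦⟧-≟ public
    using (solve; _:=_; Polynomial; con; _:+_; _:-_; _:*_; :-_)

module _ {c ℓ : Level} (R : CommutativeRing c ℓ) where
  open CommutativeRing R
  open IntegerCoefficientSolver R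
  open import Relation.Binary.Reasoning.Setoid setoid

  :1 : ∀ {n} → Polynomial n
  :1 = con (+ 1)

  :conj : ∀ {n} → Polynomial n → Polynomial n
  :conj w = :1 :- w

  :delta : ∀ {n} → Polynomial n → Polynomial n
  :delta w = w :- :conj w

  :four : ∀ {n} → Polynomial n
  :four = :1 :+ :1 :+ :1 :+ :1

  :discD : ∀ {n} → Polynomial n → Polynomial n
  :discD a = :1 :+ :four :* a

  ω*ω̄≈-a : ∀ {a ω} → ω * ω ≈ ω + a → ω * conj R ω ≈ - a
  ω*ω̄≈-a {a} {ω} ω²≈ω+a = begin
    ω * conj R ω   ≈⟨ solve 1 (λ w → w :* :conj w := w :- w :* w) refl ω ⟩
    ω - ω * ω      ≈⟨ +-congˡ (-‿cong ω²≈ω+a) ⟩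
    ω - (ω + a)    ≈⟨ solve 2 (λ w a → w :- (w :+ a) := :- a) refl ω a ⟩
    - a            ∎

  δ*δ≈D : ∀ {a ω} → ω * ω ≈ ω + a → delta R ω * delta R ω ≈ discD R a
  δ*δ≈D {a} {ω} ω²≈ω+a = begin
    delta R ω * delta R ω          ≈⟨ solve 1 (λ w → :delta w :* :delta w := :1 :- :four :* (w :* :conj w)) refl ω ⟩
    1# - four R * (ω * conj R ω)   ≈⟨ +-congˡ (-‿cong (*-congˡ (ω*ω̄≈-a ω²≈ω+a))) ⟩
    1# - four R * - a              ≈⟨ solve 1 (λ a → :1 :- :four :* :- a := :discD a) refl a ⟩
    discD R a                      ∎

  twistedForm : Carrier → Carrier → Carrier → Carrier
  twistedForm a X1 X3 = X1 * X3 - a * ((X1 - X3) * (X1 - X3))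

  twistedForm-tau : ∀ {a ω} → ω * ω ≈ ω + a → ∀ X1 X3 →
    twistedForm a (ω * X1 - conj R ω * X3) (ω * X3 - conj R ω * X1) ≈ discD R a * (X1 * X3)
  twistedForm-tau {a} {ω} ω²≈ω+a X1 X3 = begin
    twistedForm a (ω * X1 - conj R ω * X3) (ω * X3 - conj R ω * X1)
      ≈⟨ solve 4 (λ w a X1 X3 →
           (w :* X1 :- :conj w :* X3) :* (w :* X3 :- :conj w :* X1)
             :- a :* (((w :* X1 :- :conj w :* X3) :- (w :* X3 :- :conj w :* X1))
                      :* ((w :* X1 :- :conj w :* X3) :- (w :* X3 :- :conj w :* X1)))
           := X1 :* X3 :- a :* ((X1 :- X3) :* (X1 :- X3)) :- (w :* :conj w) :* ((X1 :+ X3) :* (X1 :+ X3)))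
         refl ω a X1 X3 ⟩
    twistedForm a X1 X3 - (ω * conj R ω) * ((X1 + X3) * (X1 + X3))
      ≈⟨ +-congˡ (-‿cong (*-congʳ (ω*ω̄≈-a ω²≈ω+a))) ⟩
    twistedForm a X1 X3 - (- a) * ((X1 + X3) * (X1 + X3))
      ≈⟨ solve 3 (λ a X1 X3 →
           X1 :* X3 :- a :* ((X1 :- X3) :* (X1 :- X3)) :- (:- a) :* ((X1 :+ X3) :* (X1 :+ X3))
           := :discD a :* (X1 :* X3))
         refl a X1 X3 ⟩
    discD R a * (X1 * X3) ∎

  tauInv-twistedForm : ∀ {a ω} → ω * ω ≈ ω + a → ∀ X1 X3 →
    (ω * X1 + conj R ω * X3) * (conj R ω * X1 + ω * X3) ≈ twistedForm a X1 X3
  tauInv-twistedForm {a} {ω} ω²≈ω+a X1 X3 = begin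
    (ω * X1 + conj R ω * X3) * (conj R ω * X1 + ω * X3)
      ≈⟨ solve 3 (λ w X1 X3 →
           (w :* X1 :+ :conj w :* X3) :* (:conj w :* X1 :+ w :* X3)
           := X1 :* X3 :+ (w :* :conj w) :* ((X1 :- X3) :* (X1 :- X3)))
         refl ω X1 X3 ⟩
    X1 * X3 + (ω * conj R ω) * ((X1 - X3) * (X1 - X3))
      ≈⟨ +-congˡ (*-congʳ (ω*ω̄≈-a ω²≈ω+a)) ⟩
    X1 * X3 + (- a) * ((X1 - X3) * (X1 - X3))
      ≈⟨ solve 3 (λ a X1 X3 →
           X1 :* X3 :+ (:- a) :* ((X1 :- X3) :* (X1 :- X3))
           := X1 :* X3 :- a :* ((X1 :- X3) :* (X1 :- X3)))
         refl a X1 X3 ⟩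
    twistedForm a X1 X3 ∎

  differenceOfSquares-tau : ∀ ω X1 X3 →
    (ω * X1 - conj R ω * X3) * (ω * X1 - conj R ω * X3) - (ω * X3 - conj R ω * X1) * (ω * X3 - conj R ω * X1)
      ≈ delta R ω * (X1 * X1 - X3 * X3)
  differenceOfSquares-tau = solve 3 (λ w X1 X3 →
    (w :* X1 :- :conj w :* X3) :* (w :* X1 :- :conj w :* X3) :- (w :* X3 :- :conj w :* X1) :* (w :* X3 :- :conj w :* X1)
    := :delta w :* (X1 :* X1 :- X3 :* X3)) refl

  differenceOfSquares-tauInv : ∀ ω X1 X3 →
    (ω * X1 + conj R ω * X3) * (ω * X1 + conj R ω * X3) - (conj R ω * X1 + ω * X3) * (conj R ω * X1 + ω * X3)
      ≈ delta R ω * (X1 * X1 - X3 * X3)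
  differenceOfSquares-tauInv = solve 3 (λ w X1 X3 →
    (w :* X1 :+ :conj w :* X3) :* (w :* X1 :+ :conj w :* X3) :- (:conj w :* X1 :+ w :* X3) :* (:conj w :* X1 :+ w :* X3)
    := :delta w :* (X1 :* X1 :- X3 :* X3)) refl

  OnNormalForm : Carrier × Carrier × Carrier → Pt Carrier → Set ℓ
  OnNormalForm (α , β , γ) (pt X0 X1 X2 X3) =
    (X0 * X0 - α * (X2 * X2) ≈ β * (X1 * X3)) × (X1 * X1 - X3 * X3 ≈ γ * (X0 * X2))

  OnTwistedNormalForm : Carrier → Carrier × Carrier × Carrier → Pt Carrier → Set ℓ
  OnTwistedNormalForm a (α , β , γ) (pt X0 X1 X2 X3) =
    (X0 * X0 - (discD R a * α) * (X2 * X2) ≈ β * twistedForm a X1 X3) × (X1 * X1 - X3 * X3 ≈ γ * (X0 * X2))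

  tau-onTwistedNormalForm : ∀ {a ω} → ω * ω ≈ ω + a → ∀ κ X →
    OnNormalForm κ X → OnTwistedNormalForm a κ (tau R ω X)
  tau-onTwistedNormalForm {a} {ω} ω²≈ω+a (α , β , γ) (pt X0 X1 X2 X3) (first , second) =
    first′ , second′
    where
    δ = delta R ω
    D = discD R a
    first′ : (δ * X0) * (δ * X0) - (D * α) * (X2 * X2)
               ≈ β * twistedForm a (ω * X1 - conj R ω * X3) (ω * X3 - conj R ω * X1)
    first′ = begin
      (δ * X0) * (δ * X0) - (D * α) * (X2 * X2)
        ≈⟨ solve 5 (λ δ D α X0 X2 →
             (δ :* X0) :* (δ :* X0) :- (D :* α) :* (X2 :* X2)
             := (δ :* δ) :* (X0 :* X0) :- D :* (α :* (X2 :* X2)))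
           refl δ D α X0 X2 ⟩
      (δ * δ) * (X0 * X0) - D * (α * (X2 * X2))
        ≈⟨ +-congʳ (*-congʳ (δ*δ≈D ω²≈ω+a)) ⟩
      D * (X0 * X0) - D * (α * (X2 * X2))
        ≈⟨ solve 4 (λ D α X0 X2 →
             D :* (X0 :* X0) :- D :* (α :* (X2 :* X2)) := D :* (X0 :* X0 :- α :* (X2 :* X2)))
           refl D α X0 X2 ⟩
      D * (X0 * X0 - α * (X2 * X2))
        ≈⟨ *-congˡ first ⟩
      D * (β * (X1 * X3))
        ≈⟨ solve 3 (λ D β X → D :* (β :* X) := β :* (D :* X)) refl D β (X1 * X3) ⟩
      β * (D * (X1 * X3))
        ≈⟨ *-congˡ (sym (twistedForm-tau ω²≈ω+a X1 X3)) ⟩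
      β * twistedForm a (ω * X1 - conj R ω * X3) (ω * X3 - conj R ω * X1) ∎
    second′ : (ω * X1 - conj R ω * X3) * (ω * X1 - conj R ω * X3) - (ω * X3 - conj R ω * X1) * (ω * X3 - conj R ω * X1)
                ≈ γ * ((δ * X0) * X2)
    second′ = begin
      _                          ≈⟨ differenceOfSquares-tau ω X1 X3 ⟩
      δ * (X1 * X1 - X3 * X3)    ≈⟨ *-congˡ second ⟩
      δ * (γ * (X0 * X2))        ≈⟨ solve 4 (λ δ γ X0 X2 → δ :* (γ :* (X0 :* X2)) := γ :* ((δ :* X0) :* X2)) refl δ γ X0 X2 ⟩
      γ * ((δ * X0) * X2)        ∎

  tauInv-onNormalForm : ∀ {a ω} → ω * ω ≈ ω + a → ∀ κ X →
    OnTwistedNormalForm a κ X → OnNormalForm κ (tauInv R ω X)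
  tauInv-onNormalForm {a} {ω} ω²≈ω+a (α , β , γ) (pt X0 X1 X2 X3) (first , second) =
    first′ , second′
    where
    δ = delta R ω
    D = discD R a
    first′ : X0 * X0 - α * ((δ * X2) * (δ * X2)) ≈ β * ((ω * X1 + conj R ω * X3) * (conj R ω * X1 + ω * X3))
    first′ = begin
      X0 * X0 - α * ((δ * X2) * (δ * X2))
        ≈⟨ solve 4 (λ δ α X0 X2 →
             X0 :* X0 :- α :* ((δ :* X2) :* (δ :* X2)) := X0 :* X0 :- ((δ :* δ) :* α) :* (X2 :* X2))
           refl δ α X0 X2 ⟩
      X0 * X0 - ((δ * δ) * α) * (X2 * X2)
        ≈⟨ +-congˡ (-‿cong (*-congʳ (*-congʳ (δ*δ≈D ω²≈ω+a)))) ⟩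
      X0 * X0 - (D * α) * (X2 * X2)
        ≈⟨ first ⟩
      β * twistedForm a X1 X3
        ≈⟨ *-congˡ (sym (tauInv-twistedForm ω²≈ω+a X1 X3)) ⟩
      β * ((ω * X1 + conj R ω * X3) * (conj R ω * X1 + ω * X3)) ∎
    second′ : (ω * X1 + conj R ω * X3) * (ω * X1 + conj R ω * X3) - (conj R ω * X1 + ω * X3) * (conj R ω * X1 + ω * X3)
                ≈ γ * (X0 * (δ * X2))
    second′ = begin
      _                          ≈⟨ differenceOfSquares-tauInv ω X1 X3 ⟩
      δ * (X1 * X1 - X3 * X3)    ≈⟨ *-congˡ second ⟩
      δ * (γ * (X0 * X2))        ≈⟨ solve 4 (λ δ γ X0 X2 → δ :* (γ :* (X0 :* X2)) := γ :* (X0 :* (δ :* X2))) refl δ γ X0 X2 ⟩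
      γ * (X0 * (δ * X2))        ∎

  coefficients : Model Carrier → Carrier × Carrier × Carrier
  coefficients (mu4 r)       = r , 1# , 1#
  coefficients (semisplit s) = 1# , 1# , s
  coefficients (split c)     = 1# , c * c , c * c

  ≈-respects-⇔ : ∀ {x x′ y y′} → x ≈ x′ → y ≈ y′ → (x ≈ y) ⇔ (x′ ≈ y′)
  ≈-respects-⇔ x≈x′ y≈y′ =
    mk⇔ (λ x≈y → trans (sym x≈x′) (trans x≈y y≈y′)) (λ x′≈y′ → trans x≈x′ (trans x′≈y′ (sym y≈y′)))

  1*-sym : ∀ x → x ≈ 1# * x
  1*-sym x = sym (*-identityˡ x)

  onC⇔onNormalForm : ∀ M X → OnC R M X ⇔ OnNormalForm (coefficients M) X
  onC⇔onNormalForm (mu4 r) (pt X0 X1 X2 X3) =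
    ≈-respects-⇔ refl (1*-sym _) ×-⇔ ≈-respects-⇔ refl (1*-sym _)
  onC⇔onNormalForm (semisplit s) (pt X0 X1 X2 X3) =
    ≈-respects-⇔ (+-congˡ (-‿cong (1*-sym _))) (1*-sym _) ×-⇔ ≈-respects-⇔ refl refl
  onC⇔onNormalForm (split c) (pt X0 X1 X2 X3) =
    ≈-respects-⇔ (+-congˡ (-‿cong (1*-sym _))) refl ×-⇔ ≈-respects-⇔ refl refl

  onCt⇔onTwistedNormalForm : ∀ a M X → OnCt R a M X ⇔ OnTwistedNormalForm a (coefficients M) X
  onCt⇔onTwistedNormalForm a (mu4 r) (pt X0 X1 X2 X3) =
    ≈-respects-⇔ refl (1*-sym _) ×-⇔ ≈-respects-⇔ refl (1*-sym _)
  onCt⇔onTwistedNormalForm a (semisplit s) (pt X0 X1 X2 X3) =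
    ≈-respects-⇔ (+-congˡ (-‿cong (*-congʳ (sym (*-identityʳ _))))) (1*-sym _) ×-⇔ ≈-respects-⇔ refl refl
  onCt⇔onTwistedNormalForm a (split c) (pt X0 X1 X2 X3) =
    ≈-respects-⇔ (+-congˡ (-‿cong (*-congʳ (sym (*-identityʳ _))))) refl ×-⇔ ≈-respects-⇔ refl refl

  tauInv∘tau≈δ· : ∀ ω X → _≋_ R (tauInv R ω (tau R ω X)) (scale R (delta R ω) X)
  tauInv∘tau≈δ· ω (pt X0 X1 X2 X3) =
      refl
    , solve 3 (λ w X1 X3 → w :* (w :* X1 :- :conj w :* X3) :+ :conj w :* (w :* X3 :- :conj w :* X1) := :delta w :* X1) refl ω X1 X3
    , refl
    , solve 3 (λ w X1 X3 → :conj w :* (w :* X1 :- :conj w :* X3) :+ w :* (w :* X3 :- :conj w :* X1) := :delta w :* X3) refl ω X1 X3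

  tau∘tauInv≈δ· : ∀ ω X → _≋_ R (tau R ω (tauInv R ω X)) (scale R (delta R ω) X)
  tau∘tauInv≈δ· ω (pt X0 X1 X2 X3) =
      refl
    , solve 3 (λ w X1 X3 → w :* (w :* X1 :+ :conj w :* X3) :- :conj w :* (:conj w :* X1 :+ w :* X3) := :delta w :* X1) refl ω X1 X3
    , refl
    , solve 3 (λ w X1 X3 → w :* (:conj w :* X1 :+ w :* X3) :- :conj w :* (w :* X1 :+ :conj w :* X3) := :delta w :* X3) refl ω X1 X3

  -- τ^σ is τ with ω replaced by ω̄; the scalar −1 is invisible on projective points.
  tau-conj≈-neg∘tau : ∀ ω X → _≋_ R (tau R (conj R ω) X) (scale R (- 1#) (neg R (tau R ω X)))
  tau-conj≈-neg∘tau ω (pt X0 X1 X2 X3) =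
      solve 2 (λ w X0 → :delta (:conj w) :* X0 := :- :1 :* (:delta w :* X0)) refl ω X0
    , solve 3 (λ w X1 X3 → :conj w :* X1 :- :conj (:conj w) :* X3 := :- :1 :* (w :* X3 :- :conj w :* X1)) refl ω X1 X3
    , solve 1 (λ X2 → X2 := :- :1 :* (:- X2)) refl X2
    , solve 3 (λ w X1 X3 → :conj w :* X3 :- :conj (:conj w) :* X1 := :- :1 :* (w :* X1 :- :conj w :* X3)) refl ω X1 X3

  tau[x0:1:0:1]≈δ· : ∀ ω x0 → _≋_ R (tau R ω (pt x0 1# 0# 1#)) (scale R (delta R ω) (pt x0 1# 0# 1#))
  tau[x0:1:0:1]≈δ· ω x0 = refl , ω-ω̄≈δ , solve 1 (λ w → con (+ 0) := :delta w :* con (+ 0)) refl ω , ω-ω̄≈δ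
    where
    ω-ω̄≈δ : ω * 1# - conj R ω * 1# ≈ delta R ω * 1#
    ω-ω̄≈δ = solve 1 (λ w → w :* :1 :- :conj w :* :1 := :delta w :* :1) refl ω

  tau-origin≈δ·origin : ∀ ω M → _≋_ R (tau R ω (origin R M)) (scale R (delta R ω) (origin R M))
  tau-origin≈δ·origin ω (mu4 _)       = tau[x0:1:0:1]≈δ· ω 1#
  tau-origin≈δ·origin ω (semisplit _) = tau[x0:1:0:1]≈δ· ω 1#
  tau-origin≈δ·origin ω (split c)     = tau[x0:1:0:1]≈δ· ω c

mainTheorem1 : {c ℓ c′ ℓ′ : Level} (k : CommutativeRing c ℓ) (a : CommutativeRing.Carrier k)
    (M : Model (CommutativeRing.Carrier k))
    (R : CommutativeRing c′ ℓ′)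
    (ι : CommutativeRing.Carrier k → CommutativeRing.Carrier R)
    → IsRingHomomorphism (CommutativeRing.rawRing k) (CommutativeRing.rawRing R) ι
    → (ω : CommutativeRing.Carrier R)
    → CommutativeRing._≈_ R (CommutativeRing._*_ R ω ω) (CommutativeRing._+_ R ω (ι a))
    → ((X : Pt (CommutativeRing.Carrier R)) → OnC R (mapModel ι M) X → OnCt R (ι a) (mapModel ι M) (tau R ω X))
    × ((X : Pt (CommutativeRing.Carrier R)) → OnCt R (ι a) (mapModel ι M) X → OnC R (mapModel ι M) (tauInv R ω X))
    × ((X : Pt (CommutativeRing.Carrier R)) → _≋_ R (tauInv R ω (tau R ω X)) (scale R (delta R ω) X))
    × ((X : Pt (CommutativeRing.Carrier R)) → _≋_ R (tau R ω (tauInv R ω X)) (scale R (delta R ω) X))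
    × ((X : Pt (CommutativeRing.Carrier R)) → _≋_ R (tau R (conj R ω) X) (scale R (CommutativeRing.-_ R (CommutativeRing.1# R)) (neg R (tau R ω X))))
    × _≋_ R (tau R ω (origin R (mapModel ι M))) (scale R (delta R ω) (origin R (mapModel ι M)))
mainTheorem1 k a M R ι _ ω ω²≈ω+a =
    (λ X onC → from (onCt⇔ (tau R ω X)) (tau-onTwistedNormalForm R ω²≈ω+a κ X (to (onC⇔ X) onC)))
  , (λ X onCt → from (onC⇔ (tauInv R ω X)) (tauInv-onNormalForm R ω²≈ω+a κ X (to (onCt⇔ X) onCt)))
  , tauInv∘tau≈δ· R ω
  , tau∘tauInv≈δ· R ω
  , tau-conj≈-neg∘tau R ω
  , tau-origin≈δ·origin R ω M′
  where
  open Equivalence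
  M′ = mapModel ι M
  κ  = coefficients R M′
  onC⇔  = onC⇔onNormalForm R M′
  onCt⇔ = onCt⇔onTwistedNormalForm R (ι a) M′
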